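{- For every integer $k\geq 2$, $\chi'_k(K_{1,k,k})=k+2$, where $K_{1,k,k}$ is the complete $3$-partite graph with parts of sizes $1$, $k$ and $k$.
   Context: For an integer $k\geq 2$, a $\chi'_k$-coloring of a graph $G$ is a coloring of the edges of $G$ such that, for each color, every vertex incident to an edge of that color is incident to a number of edges of that color congruent to $1\pmod k$. The mod $k$ chromatic index $\chi'_k(G)$ is the minimum number of colors in a $\chi'_k$-coloring of $G$. -}

module Defs where

open import Data.Nat using (ℕ; zero; suc; _+_; _*_; _≤_; _<_; _≤ᵇ_)
open import Data.Nat.Properties using ()
open import Data.Bool using (Bool; true; false; if_then_else_; _∧_; not)
open import Data.Fin using (Fin; toℕ)
open import Data.Fin.Properties using () renaming (_≟_ to _≟ᶠ_)
open import Data.List using (List; map)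
open import Data.Nat.ListAction using (sum)
open import Data.List.Base using (allFin)
open import Data.Product using (Σ; ∃; _×_; _,_)
open import Data.Sum using (_⊎_)
open import Relation.Nullary using (¬_; does)
open import Relation.Binary.PropositionalEquality using (_≡_)

record Graph : Set where
  field
    n     : ℕ
    adj   : Fin n → Fin n → Bool
    sym   : ∀ u v → adj u v ≡ adj v u
    irrefl : ∀ v → adj v v ≡ false
open Graph public

bool→ℕ : Bool → ℕ
bool→ℕ true  = 1
bool→ℕ false = 0

-- An edge coloring with colors Fin m: a color assigned to each (unordered)
-- pair, i.e. a symmetric function; only its values on edges matter.
record EdgeColoring (G : Graph) (m : ℕ) : Set where
  field
    col    : Fin (n G) → Fin (n G) → Fin m
    colSym : ∀ u v → col u v ≡ col v u
open EdgeColoring public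

colorDeg : (G : Graph) {m : ℕ} → EdgeColoring G m → Fin (n G) → Fin m → ℕ
colorDeg G c v i =
  sum (map (λ u → bool→ℕ (adj G v u ∧ does (col c v u ≟ᶠ i))) (allFin (n G)))

_≡1mod_ : ℕ → ℕ → Set
d ≡1mod k = ∃ λ q → d ≡ 1 + q * k

IsModColoring : (k : ℕ) (G : Graph) {m : ℕ} → EdgeColoring G m → Set
IsModColoring k G c =
  ∀ (v : Fin (n G)) (i : Fin _) → colorDeg G c v i ≡ 0 ⊎ colorDeg G c v i ≡1mod k

HasModColoring : (k : ℕ) (G : Graph) (m : ℕ) → Set
HasModColoring k G m = Σ (EdgeColoring G m) (IsModColoring k G)

ModChromaticIndex≡ : (k : ℕ) (G : Graph) (m : ℕ) → Set
ModChromaticIndex≡ k G m =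
  HasModColoring k G m × (∀ m' → m' < m → ¬ HasModColoring k G m')

-- Complete 3-partite graph K_{1,k,k} on Fin (1 + k + k):
-- vertex 0 is part 0, vertices 1..k are part 1, vertices k+1..2k are part 2.
part : (k : ℕ) → ℕ → ℕ
part k zero    = 0
part k (suc v) = if suc v ≤ᵇ k then 1 else 2

partEq : ℕ → ℕ → Bool
partEq zero zero = true
partEq (suc a) (suc b) = partEq a b
partEq _ _ = false

K1kkAdj : (k : ℕ) → Fin (1 + k + k) → Fin (1 + k + k) → Bool
K1kkAdj k u v = not (partEq (part k (toℕ u)) (part k (toℕ v)))

private
  partEq-sym : ∀ a b → partEq a b ≡ partEq b a
  partEq-sym zero zero = _≡_.refl
  partEq-sym zero (suc b) = _≡_.refl
  partEq-sym (suc a) zero = _≡_.refl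
  partEq-sym (suc a) (suc b) = partEq-sym a b

  partEq-refl : ∀ a → partEq a a ≡ true
  partEq-refl zero = _≡_.refl
  partEq-refl (suc a) = partEq-refl a

  open import Relation.Binary.PropositionalEquality using (cong)

K1kk : ℕ → Graph
K1kk k = record
  { n = 1 + k + k
  ; adj = K1kkAdj k
  ; sym = λ u v → cong not (partEq-sym (part k (toℕ u)) (part k (toℕ v)))
  ; irrefl = λ v → cong not (partEq-refl (part k (toℕ v)))
  }

-- Give every spoke (edge at the center) to A, and the spoke to b₀, the extra color k+1; give the edge
-- aᵢbⱼ the color (i+j+1) mod (k+1), and the spoke to bⱼ (j ≠ 0) the residue j, the only one
-- missing at bⱼ. Every vertex of A ∪ B then sees each color at most once, and the center sees
-- k+1 exactly k+1 times and every other color at most once.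
--
-- Suppose at most k+1 colors. A vertex of A ∪ B has degree k+1, so it is
-- monochromatic or, with exactly k+1 colors, rainbow: its color degrees are congruent mod k+1.
-- The center has degree 2k, which forces a color i seen there exactly once and, with k+1
-- colors, a color z not seen there. Summing color degrees over A (resp. B) counts the A–B
-- edges of a color plus the spokes of that color to A (resp. B); comparing i with z (or with
-- residue 0 if there are at most k colors) makes the numbers of i-colored spokes to A and to B
-- congruent mod k+1, although exactly one of them is 1 and the other 0.
module Submission where

open import Data.Bool using (if_then_else_; not; _∧_)
open import Data.Empty using (⊥)
open import Data.Fin using (Fin; zero; suc; toℕ; fromℕ<; punchIn; punchOut; _↑ˡ_; _↑ʳ_; splitAt)
import Data.Fin.Properties as Finₚ
open Finₚ using (any?; toℕ-injective; toℕ<n; toℕ-fromℕ<; fromℕ<-cong; toℕ-↑ˡ; toℕ-↑ʳ;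
                 splitAt-↑ˡ; splitAt-↑ʳ; punchIn-punchOut)
  renaming (_≟_ to _≟ᶠ_)
open import Data.List using (map; allFin; tabulate)
open import Data.List.Properties using (map-tabulate)
open import Data.Nat using (ℕ; zero; suc; _+_; _∸_; _*_; _≤_; _<_; z≤n; s≤s; s≤s⁻¹; NonZero; _≟_)
open import Data.Nat.DivMod using (_%_; _/_; %-distribˡ-+; m≡m%n+[m/n]*n; n%n≡0; m%n<n; m<n⇒m%n≡m)
open import Data.Nat.Divisibility using (_∣_; divides; ∣m+n∣m⇒∣n; n∣m*n; n∣m⇒m%n≡0)
import Data.Nat.ListAction as List
open import Data.Nat.Properties
open import Algebra.Properties.CommutativeMonoid.Sum +-0-commutativeMonoid
  using (sum; sum-syntax; sum-remove; sum-cong-≗; ∑-distrib-+; ∑-comm; sum-replicate-zero)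
open import Data.Product using (∃; _,_)
open import Data.Sum using (_⊎_; inj₁; inj₂; [_,_]′)
open import Data.Vec.Functional using (removeAt; _∷_)
open import Function using (_∘_; id)
open import Function.Definitions using (Injective)
open import Relation.Binary.PropositionalEquality
open import Relation.Nullary using (contradiction; does; yes; no)
open import Relation.Nullary.Decidable using (dec-true; dec-false)

open import Defs hiding (n; sym)

sum-tabulate : ∀ {n} (f : Fin n → ℕ) → List.sum (tabulate f) ≡ sum f
sum-tabulate {zero}  f = refl
sum-tabulate {suc n} f = cong (f zero +_) (sum-tabulate (f ∘ suc))

sum-map-allFin : ∀ {n} (f : Fin n → ℕ) → List.sum (map f (allFin n)) ≡ sum f
sum-map-allFin f = trans (cong List.sum (map-tabulate id f)) (sum-tabulate f)

∑-split : ∀ a b (f : Fin (a + b) → ℕ) → sum f ≡ sum (f ∘ (_↑ˡ b)) + sum (f ∘ (a ↑ʳ_))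
∑-split zero    b f = refl
∑-split (suc a) b f = trans (cong (f zero +_) (∑-split a b (f ∘ suc))) (sym (+-assoc (f zero) _ _))

∑-ones : ∀ n → ∑[ i < n ] 1 ≡ n
∑-ones zero    = refl
∑-ones (suc n) = cong suc (∑-ones n)

∑-zeros : ∀ {n} {f : Fin n → ℕ} → (∀ i → f i ≡ 0) → sum f ≡ 0
∑-zeros {n} f≡0 = trans (sum-cong-≗ f≡0) (sum-replicate-zero n)

∑-mono-≤ : ∀ {n} {f g : Fin n → ℕ} → (∀ i → f i ≤ g i) → sum f ≤ sum g
∑-mono-≤ {zero}  f≤g = z≤n
∑-mono-≤ {suc n} f≤g = +-mono-≤ (f≤g zero) (∑-mono-≤ (f≤g ∘ suc))

term≤∑ : ∀ {n} (f : Fin n → ℕ) i → f i ≤ sum f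
term≤∑ {suc n} f i = ≤-trans (m≤m+n (f i) _) (≤-reflexive (sym (sum-remove {i = i} f)))

∑-cong-% : ∀ {n} d .{{_ : NonZero d}} {f g : Fin n → ℕ} →
           (∀ i → f i % d ≡ g i % d) → sum f % d ≡ sum g % d
∑-cong-% {zero}  d eq = refl
∑-cong-% {suc n} d {f} {g} eq = begin
  (f zero + sum (f ∘ suc)) % d          ≡⟨ %-distribˡ-+ (f zero) _ d ⟩
  (f zero % d + sum (f ∘ suc) % d) % d  ≡⟨ cong₂ (λ x y → (x + y) % d) (eq zero) (∑-cong-% d (eq ∘ suc)) ⟩
  (g zero % d + sum (g ∘ suc) % d) % d  ≡⟨ %-distribˡ-+ (g zero) _ d ⟨
  (g zero + sum (g ∘ suc)) % d          ∎
  where open ≡-Reasoning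

[d+w]%n≡w%n⇒d≡0 : ∀ {n} .{{_ : NonZero n}} {d} w → d < n → (d + w) % n ≡ w % n → d ≡ 0
[d+w]%n≡w%n⇒d≡0 {n} {d} w d<n eq = trans (sym (m<n⇒m%n≡m d<n)) (n∣m⇒m%n≡0 d n n∣d)
  where
  open ≡-Reasoning
  quotients : w / n * n + d ≡ (d + w) / n * n
  quotients = +-cancelˡ-≡ (w % n) _ _ (begin
    w % n + (w / n * n + d)        ≡⟨ +-assoc (w % n) _ d ⟨
    w % n + w / n * n + d          ≡⟨ cong (_+ d) (m≡m%n+[m/n]*n w n) ⟨
    w + d                          ≡⟨ +-comm w d ⟩
    d + w                          ≡⟨ m≡m%n+[m/n]*n (d + w) n ⟩
    (d + w) % n + (d + w) / n * n  ≡⟨ cong (_+ (d + w) / n * n) eq ⟩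
    w % n + (d + w) / n * n        ∎)
  n∣d : n ∣ d
  n∣d = ∣m+n∣m⇒∣n (divides ((d + w) / n) quotients) (n∣m*n (w / n))

[i+w]%n≡[j+w]%n⇒i≡j : ∀ {n} .{{_ : NonZero n}} {i j} w → i < n → j < n →
                      (i + w) % n ≡ (j + w) % n → i ≡ j
[i+w]%n≡[j+w]%n⇒i≡j {n} {i} {j} w i<n j<n eq =
  [ (λ i≤j → ≤-antisym i≤j (≥-of-≤ i≤j j<n eq))
  , (λ j≤i → ≤-antisym (≥-of-≤ j≤i i<n (sym eq)) j≤i)
  ]′ (≤-total i j)
  where
  ≥-of-≤ : ∀ {x y} → x ≤ y → y < n → (x + w) % n ≡ (y + w) % n → y ≤ x
  ≥-of-≤ {x} {y} x≤y y<n eq′ =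
    m∸n≡0⇒m≤n ([d+w]%n≡w%n⇒d≡0 (x + w) (≤-<-trans (m∸n≤m y x) y<n)
                                   (trans (cong (_% n) y∸x+[x+w]≡y+w) (sym eq′)))
    where
    y∸x+[x+w]≡y+w : y ∸ x + (x + w) ≡ y + w
    y∸x+[x+w]≡y+w = trans (sym (+-assoc (y ∸ x) x w)) (cong (_+ w) (m∸n+n≡m x≤y))

[w+i]%n≡[w+j]%n⇒i≡j : ∀ {n} .{{_ : NonZero n}} {i j} w → i < n → j < n →
                      (w + i) % n ≡ (w + j) % n → i ≡ j
[w+i]%n≡[w+j]%n⇒i≡j {n} {i} {j} w i<n j<n eq =
  [i+w]%n≡[j+w]%n⇒i≡j w i<n j<n (trans (cong (_% n) (+-comm i w)) (trans eq (cong (_% n) (+-comm w j))))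

[k+k]%[1+k]≢0 : ∀ {k} → 2 ≤ k → (k + k) % suc k ≢ 0
[k+k]%[1+k]≢0 {suc k} (s≤s 1≤k) [k+k]%[1+k]≡0 = contradiction k≡0 (≢-sym (<⇒≢ 1≤k))
  where
  k≡0 : k ≡ 0
  k≡0 = [d+w]%n≡w%n⇒d≡0 (suc (suc k)) (<-trans (n<1+n k) (n<1+n (suc k)))
          (trans (cong (_% suc (suc k)) (+-suc k (suc k))) (trans [k+k]%[1+k]≡0 (sym (n%n≡0 (suc (suc k))))))

m+m≢1 : ∀ m → m + m ≢ 1
m+m≢1 zero    ()
m+m≢1 (suc m) 2+2m≡1 = m+1+n≢0 m (suc-injective 2+2m≡1)

δ : ∀ {m} → Fin m → Fin m → ℕ
δ x y = bool→ℕ (does (x ≟ᶠ y))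

δ-refl : ∀ {m} (x : Fin m) → δ x x ≡ 1
δ-refl x = cong bool→ℕ (dec-true (x ≟ᶠ x) refl)

δ-≢ : ∀ {m} {x y : Fin m} → x ≢ y → δ x y ≡ 0
δ-≢ {x = x} {y} x≢y = cong bool→ℕ (dec-false (x ≟ᶠ y) x≢y)

∑-δ : ∀ {m} (x : Fin m) → ∑[ y < m ] δ x y ≡ 1
∑-δ {suc m} zero    = cong suc (∑-zeros {m} λ _ → refl)
∑-δ {suc m} (suc x) = ∑-δ x

occurrences : ∀ {n m} → (Fin n → Fin m) → Fin m → ℕ
occurrences {n} h y = ∑[ i < n ] δ (h i) y

∑-occurrences : ∀ {n m} (h : Fin n → Fin m) → ∑[ y < m ] occurrences h y ≡ n
∑-occurrences {n} {m} h = begin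
  ∑[ y < m ] ∑[ i < n ] δ (h i) y  ≡⟨ ∑-comm (λ i y → δ (h i) y) ⟨
  ∑[ i < n ] ∑[ y < m ] δ (h i) y  ≡⟨ sum-cong-≗ (∑-δ ∘ h) ⟩
  ∑[ i < n ] 1                     ≡⟨ ∑-ones n ⟩
  n                                ∎
  where open ≡-Reasoning

occurrences≤1 : ∀ {n m} {h : Fin n → Fin m} → Injective _≡_ _≡_ h → ∀ y → occurrences h y ≤ 1
occurrences≤1 {zero}          h-inj y = z≤n
occurrences≤1 {suc n} {h = h} h-inj y with h zero ≟ᶠ y
... | yes refl = ≤-reflexive (cong suc (∑-zeros {n} λ i → δ-≢ (Finₚ.0≢1+n ∘ h-inj ∘ sym)))
... | no  _    = occurrences≤1 (Finₚ.suc-injective ∘ h-inj) y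

∷-injective : ∀ {A : Set} {n} {x : A} {h : Fin n → A} →
              (∀ i → h i ≢ x) → Injective _≡_ _≡_ h → Injective _≡_ _≡_ (x ∷ h)
∷-injective h≢x h-inj {zero}  {zero}  _     = refl
∷-injective h≢x h-inj {zero}  {suc j} x≡hj  = contradiction (sym x≡hj) (h≢x j)
∷-injective h≢x h-inj {suc i} {zero}  hi≡x  = contradiction hi≡x (h≢x i)
∷-injective h≢x h-inj {suc i} {suc j} hi≡hj = cong suc (h-inj hi≡hj)

injective-via-toℕ : ∀ {n m} {g : Fin n → Fin m} {h : Fin n → ℕ} →
                    (∀ i → toℕ (g i) ≡ h i) → Injective _≡_ _≡_ h → Injective _≡_ _≡_ g
injective-via-toℕ toℕ∘g≗h h-inj {i} {j} gi≡gj =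
  h-inj (trans (sym (toℕ∘g≗h i)) (trans (cong toℕ gi≡gj) (toℕ∘g≗h j)))

-- Color degrees at a single vertex

ModDegree : ℕ → ℕ → Set
ModDegree k d = d ≡ 0 ⊎ d ≡1mod k

ModDegrees : ℕ → ∀ {m} → (Fin m → ℕ) → Set
ModDegrees k f = ∀ i → ModDegree k (f i)

≤1⇒ModDegree : ∀ k {d} → d ≤ 1 → ModDegree k d
≤1⇒ModDegree k z≤n       = inj₁ refl
≤1⇒ModDegree k (s≤s z≤n) = inj₂ (0 , refl)

≡1mod⇒≡1⊎1+k≤ : ∀ {d k} → d ≡1mod k → d ≡ 1 ⊎ suc k ≤ d
≡1mod⇒≡1⊎1+k≤         (zero  , refl) = inj₁ refl
≡1mod⇒≡1⊎1+k≤ {k = k} (suc q , refl) = inj₂ (s≤s (m≤m+n k (q * k)))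

≡1mod∧≤2k⇒≡1⊎≡1+k : ∀ {d k} → d ≡1mod k → d ≤ k + k → d ≡ 1 ⊎ d ≡ suc k
≡1mod∧≤2k⇒≡1⊎≡1+k         (zero        , refl) _    = inj₁ refl
≡1mod∧≤2k⇒≡1⊎≡1+k {k = k} (suc zero    , refl) _    = inj₂ (cong suc (+-identityʳ k))
≡1mod∧≤2k⇒≡1⊎≡1+k {k = k} (suc (suc q) , refl) d≤2k =
  contradiction d≤2k (<⇒≱ (s≤s (+-monoʳ-≤ k (m≤m+n k (q * k)))))

≤1∧n≤∑⇒≡1 : ∀ {n} (f : Fin n → ℕ) → (∀ i → f i ≤ 1) → n ≤ sum f → ∀ i → f i ≡ 1
≤1∧n≤∑⇒≡1 {suc n} f f≤1 n≤∑ i = ≤-antisym (f≤1 i) (+-cancelʳ-≤ n 1 (f i) (begin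
  suc n                     ≤⟨ n≤∑ ⟩
  sum f                     ≡⟨ sum-remove f ⟩
  f i + sum (removeAt f i)  ≤⟨ +-monoʳ-≤ (f i) (∑-mono-≤ (f≤1 ∘ punchIn i)) ⟩
  f i + ∑[ j < n ] 1        ≡⟨ cong (f i +_) (∑-ones n) ⟩
  f i + n                   ∎))
  where open ≤-Reasoning

monochromatic-or-rainbow : ∀ {k m} (f : Fin m → ℕ) → ModDegrees k f → sum f ≡ suc k → m ≤ suc k →
                           (∀ i → f i % suc k ≡ 0) ⊎ (∀ i → f i ≡ 1)
monochromatic-or-rainbow {k} {zero}  f f-mod ∑f≡1+k m≤1+k = inj₂ λ ()
monochromatic-or-rainbow {k} {suc m} f f-mod ∑f≡1+k m≤1+k with any? (λ i → 2 ≤? f i)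
... | no  none≥2     = inj₂ (≤1∧n≤∑⇒≡1 f (λ i → ≤-pred (≰⇒> (none≥2 ∘ (i ,_))))
                                          (≤-trans m≤1+k (≤-reflexive (sym ∑f≡1+k))))
... | yes (w , 2≤fw) = inj₁ residue0
  where
  fw≡1+k : f w ≡ suc k
  fw≡1+k with f-mod w
  ... | inj₁ fw≡0    = contradiction (≤-trans 2≤fw (≤-reflexive fw≡0)) λ ()
  ... | inj₂ fw≡1mod = ≤-antisym (≤-trans (term≤∑ f w) (≤-reflexive ∑f≡1+k))
    ([ (λ fw≡1 → contradiction (≤-trans 2≤fw (≤-reflexive fw≡1)) λ { (s≤s ()) }) , id ]′
       (≡1mod⇒≡1⊎1+k≤ fw≡1mod))
  others≡0 : sum (removeAt f w) ≡ 0
  others≡0 = +-cancelˡ-≡ (suc k) _ 0 (begin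
    suc k + sum (removeAt f w)  ≡⟨ cong (_+ sum (removeAt f w)) fw≡1+k ⟨
    f w + sum (removeAt f w)    ≡⟨ sum-remove f ⟨
    sum f                       ≡⟨ ∑f≡1+k ⟩
    suc k                       ≡⟨ +-identityʳ (suc k) ⟨
    suc k + 0                   ∎)
    where open ≡-Reasoning
  residue0 : ∀ i → f i % suc k ≡ 0
  residue0 i with w ≟ᶠ i
  ... | yes refl = trans (cong (_% suc k) fw≡1+k) (n%n≡0 (suc k))
  ... | no  w≢i  = cong (_% suc k) (n≤0⇒n≡0 (begin
    f i                          ≡⟨ cong f (punchIn-punchOut w≢i) ⟨
    removeAt f w (punchOut w≢i)  ≤⟨ term≤∑ (removeAt f w) (punchOut w≢i) ⟩
    sum (removeAt f w)           ≡⟨ others≡0 ⟩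
    0                            ∎))
    where open ≤-Reasoning

residues-equal : ∀ {k m} (f : Fin m → ℕ) → ModDegrees k f → sum f ≡ suc k → m ≤ suc k →
                 ∀ i j → f i % suc k ≡ f j % suc k
residues-equal {k} f f-mod ∑f≡1+k m≤1+k i j with monochromatic-or-rainbow f f-mod ∑f≡1+k m≤1+k
... | inj₁ residue0 = trans (residue0 i) (sym (residue0 j))
... | inj₂ all≡1    = cong (_% suc k) (trans (all≡1 i) (sym (all≡1 j)))

few-colors⇒residue0 : ∀ {k m} (f : Fin m → ℕ) → ModDegrees k f → sum f ≡ suc k → m ≤ k →
                       ∀ i → f i % suc k ≡ 0
few-colors⇒residue0 {k} {m} f f-mod ∑f≡1+k m≤k with monochromatic-or-rainbow f f-mod ∑f≡1+k (m≤n⇒m≤1+n m≤k)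
... | inj₁ residue0 = residue0
... | inj₂ all≡1    = contradiction (begin
  suc k         ≡⟨ ∑f≡1+k ⟨
  sum f         ≡⟨ sum-cong-≗ all≡1 ⟩
  ∑[ i < m ] 1  ≡⟨ ∑-ones m ⟩
  m             ≤⟨ m≤k ⟩
  k             ∎) 1+n≰n
  where open ≤-Reasoning

simple-color : ∀ {k m} → 2 ≤ k → (f : Fin m → ℕ) → ModDegrees k f → sum f ≡ k + k → ∃ λ i → f i ≡ 1
simple-color {k} {m} 2≤k f f-mod ∑f≡2k with any? (λ i → f i ≟ 1)
... | yes found = found
... | no  none  = contradiction (begin
  (k + k) % suc k         ≡⟨ cong (_% suc k) ∑f≡2k ⟨
  sum f % suc k           ≡⟨ ∑-cong-% (suc k) {g = λ _ → 0} residue0 ⟩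
  (∑[ i < m ] 0) % suc k  ≡⟨ cong (_% suc k) (∑-zeros {m} λ _ → refl) ⟩
  0                       ∎) ([k+k]%[1+k]≢0 2≤k)
  where
  open ≡-Reasoning
  residue0 : ∀ i → f i % suc k ≡ 0 % suc k
  residue0 i with f-mod i
  ... | inj₁ fi≡0    = cong (_% suc k) fi≡0
  ... | inj₂ fi≡1mod = [ (λ fi≡1 → contradiction (i , fi≡1) none)
                       , (λ fi≡1+k → trans (cong (_% suc k) fi≡1+k) (n%n≡0 (suc k)))
                       ]′ (≡1mod∧≤2k⇒≡1⊎≡1+k fi≡1mod (≤-trans (term≤∑ f i) (≤-reflexive ∑f≡2k)))

absent-color : ∀ {k m} → m ≡ suc k → 2 ≤ k → (f : Fin m → ℕ) → ModDegrees k f → sum f ≡ k + k →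
                ∃ λ i → f i ≡ 0
absent-color {k} refl 2≤k f f-mod ∑f≡2k with any? (λ i → f i ≟ 0)
... | yes found = found
... | no  none  = contradiction k≡1 (≢-sym (<⇒≢ 2≤k))
  where
  each≤k : ∀ i → f i ≤ k
  each≤k i = +-cancelˡ-≤ k (f i) k (begin
    k + f i                   ≡⟨ cong (_+ f i) (∑-ones k) ⟨
    ∑[ j < k ] 1 + f i        ≤⟨ +-monoˡ-≤ (f i) (∑-mono-≤ λ j → n≢0⇒n>0 λ e → none (punchIn i j , e)) ⟩
    sum (removeAt f i) + f i  ≡⟨ +-comm _ (f i) ⟩
    f i + sum (removeAt f i)  ≡⟨ sum-remove f ⟨
    sum f                     ≡⟨ ∑f≡2k ⟩
    k + k                     ∎)
    where open ≤-Reasoning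
  each≡1 : ∀ i → f i ≡ 1
  each≡1 i with f-mod i
  ... | inj₁ fi≡0    = contradiction (i , fi≡0) none
  ... | inj₂ fi≡1mod = [ id , (λ 1+k≤fi → contradiction (≤-trans 1+k≤fi (each≤k i)) 1+n≰n) ]′
                         (≡1mod⇒≡1⊎1+k≤ fi≡1mod)
  k≡1 : k ≡ 1
  k≡1 = +-cancelˡ-≡ k k 1 (begin
    k + k             ≡⟨ ∑f≡2k ⟨
    sum f             ≡⟨ sum-cong-≗ each≡1 ⟩
    ∑[ i < suc k ] 1  ≡⟨ ∑-ones (suc k) ⟩
    suc k             ≡⟨ +-comm 1 k ⟩
    k + 1             ∎)
    where open ≡-Reasoning

module K1kkVertices (k : ℕ) where

  center : Fin (1 + k + k)
  center = zero

  vA vB : Fin k → Fin (1 + k + k)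
  vA a = suc (a ↑ˡ k)
  vB b = suc (k ↑ʳ b)

  part-center : part k (toℕ center) ≡ 0
  part-center = refl

  part-vA : ∀ a → part k (toℕ (vA a)) ≡ 1
  part-vA a rewrite toℕ-↑ˡ a k = cong (if_then 1 else 2) (dec-true (suc (toℕ a) ≤? k) (toℕ<n a))

  part-vB : ∀ b → part k (toℕ (vB b)) ≡ 2
  part-vB b rewrite toℕ-↑ʳ k b =
    cong (if_then 1 else 2) (dec-false (suc (k + toℕ b) ≤? k) (<⇒≱ (s≤s (m≤m+n k (toℕ b)))))

  data Vertex : Fin (1 + k + k) → Set where
    center-vertex : Vertex center
    A-vertex      : ∀ a → Vertex (vA a)
    B-vertex      : ∀ b → Vertex (vB b)

  vertex : ∀ v → Vertex v
  vertex zero    = center-vertex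
  vertex (suc w) with splitAt k w in eq
  ... | inj₁ a = subst (Vertex ∘ suc) (Finₚ.splitAt⁻¹-↑ˡ eq) (A-vertex a)
  ... | inj₂ b = subst (Vertex ∘ suc) (Finₚ.splitAt⁻¹-↑ʳ eq) (B-vertex b)

  module Degrees {m} (c : EdgeColoring (K1kk k) m) where

    p q : Fin k → Fin m
    p a = col c center (vA a)
    q b = col c center (vB b)

    r : Fin k → Fin k → Fin m
    r a b = col c (vA a) (vB b)

    incidence : Fin (1 + k + k) → Fin m → Fin (1 + k + k) → ℕ
    incidence v i u = bool→ℕ (K1kkAdj k v u ∧ does (col c v u ≟ᶠ i))

    incidence-parts : ∀ v u {s t} i → part k (toℕ v) ≡ s → part k (toℕ u) ≡ t →
                      incidence v i u ≡ bool→ℕ (not (partEq s t) ∧ does (col c v u ≟ᶠ i))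
    incidence-parts v u i = cong₂ (λ s t → bool→ℕ (not (partEq s t) ∧ does (col c v u ≟ᶠ i)))

    colorDeg-split : ∀ v i → colorDeg (K1kk k) c v i ≡
                     incidence v i center + (sum (incidence v i ∘ vA) + sum (incidence v i ∘ vB))
    colorDeg-split v i = trans (sum-map-allFin (incidence v i)) (cong (incidence v i center +_) (∑-split k k _))

    colorDeg-center : ∀ i → colorDeg (K1kk k) c center i ≡ occurrences p i + occurrences q i
    colorDeg-center i = trans (colorDeg-split center i)
      (cong₂ _+_ (sum-cong-≗ λ a → incidence-parts center (vA a) i part-center (part-vA a))
                 (sum-cong-≗ λ b → incidence-parts center (vB b) i part-center (part-vB b)))

    colorDeg-vA : ∀ a i → colorDeg (K1kk k) c (vA a) i ≡ occurrences (p a ∷ r a) i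
    colorDeg-vA a i = trans (colorDeg-split (vA a) i)
      (cong₂ _+_ (trans (from center part-center) (cong (λ x → δ x i) (colSym c (vA a) center)))
                 (cong₂ _+_ (∑-zeros λ a′ → from (vA a′) (part-vA a′))
                            (sum-cong-≗ λ b → from (vB b) (part-vB b))))
      where
      from : ∀ u {t} → part k (toℕ u) ≡ t →
             incidence (vA a) i u ≡ bool→ℕ (not (partEq 1 t) ∧ does (col c (vA a) u ≟ᶠ i))
      from u = incidence-parts (vA a) u i (part-vA a)

    colorDeg-vB : ∀ b i → colorDeg (K1kk k) c (vB b) i ≡ occurrences (q b ∷ λ a → r a b) i
    colorDeg-vB b i = trans (colorDeg-split (vB b) i)
      (cong₂ _+_ (trans (from center part-center) (cong (λ x → δ x i) (colSym c (vB b) center)))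
                 (trans (cong₂ _+_ (sum-cong-≗ λ a → trans (from (vA a) (part-vA a))
                                                           (cong (λ x → δ x i) (colSym c (vB b) (vA a))))
                                   (∑-zeros λ b′ → from (vB b′) (part-vB b′)))
                        (+-identityʳ _)))
      where
      from : ∀ u {t} → part k (toℕ u) ≡ t →
             incidence (vB b) i u ≡ bool→ℕ (not (partEq 2 t) ∧ does (col c (vB b) u ≟ᶠ i))
      from u = incidence-parts (vB b) u i (part-vB b)

module LowerBound {k m} (2≤k : 2 ≤ k) (m≤1+k : m ≤ suc k)
                  (c : EdgeColoring (K1kk k) m) (c-mod : IsModColoring k (K1kk k) c) where
  open K1kkVertices k
  open Degrees c

  degA degB : Fin k → Fin m → ℕ
  degA a = occurrences (p a ∷ r a)
  degB b = occurrences (q b ∷ λ a → r a b)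

  center-mod : ModDegrees k (λ i → occurrences p i + occurrences q i)
  center-mod i = subst (ModDegree k) (colorDeg-center i) (c-mod center i)

  degA-mod : ∀ a → ModDegrees k (degA a)
  degA-mod a i = subst (ModDegree k) (colorDeg-vA a i) (c-mod (vA a) i)

  degB-mod : ∀ b → ModDegrees k (degB b)
  degB-mod b i = subst (ModDegree k) (colorDeg-vB b i) (c-mod (vB b) i)

  degA-total : ∀ a → sum (degA a) ≡ suc k
  degA-total a = ∑-occurrences (p a ∷ r a)

  degB-total : ∀ b → sum (degB b) ≡ suc k
  degB-total b = ∑-occurrences (q b ∷ λ a → r a b)

  ∑-center : ∑[ i < m ] (occurrences p i + occurrences q i) ≡ k + k
  ∑-center = trans (∑-distrib-+ (occurrences p) (occurrences q)) (cong₂ _+_ (∑-occurrences p) (∑-occurrences q))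

  crossing : Fin m → ℕ
  crossing i = ∑[ a < k ] occurrences (r a) i

  ∑-degA : ∀ i → ∑[ a < k ] degA a i ≡ occurrences p i + crossing i
  ∑-degA i = ∑-distrib-+ (λ a → δ (p a) i) (λ a → occurrences (r a) i)

  ∑-degB : ∀ i → ∑[ b < k ] degB b i ≡ occurrences q i + crossing i
  ∑-degB i = trans (∑-distrib-+ (λ b → δ (q b) i) (λ b → occurrences (λ a → r a b) i))
                   (cong (occurrences q i +_) (∑-comm (λ b a → δ (r a b) i)))

  sides-congruent : ∀ i → (∑[ a < k ] degA a i) % suc k ≡ (∑[ b < k ] degB b i) % suc k
  sides-congruent i = [ few ∘ s≤s⁻¹ , full ]′ (m≤n⇒m<n∨m≡n m≤1+k)
    where
    few : m ≤ k → (∑[ a < k ] degA a i) % suc k ≡ (∑[ b < k ] degB b i) % suc k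
    few m≤k =
      trans (∑-cong-% (suc k) {g = λ _ → 0} λ a → few-colors⇒residue0 (degA a) (degA-mod a) (degA-total a) m≤k i)
            (sym (∑-cong-% (suc k) λ b → few-colors⇒residue0 (degB b) (degB-mod b) (degB-total b) m≤k i))
    full : m ≡ suc k → (∑[ a < k ] degA a i) % suc k ≡ (∑[ b < k ] degB b i) % suc k
    full m≡1+k with absent-color m≡1+k 2≤k _ center-mod ∑-center
    ... | z , pz+qz≡0 =
      trans (∑-cong-% (suc k) λ a → residues-equal (degA a) (degA-mod a) (degA-total a) m≤1+k i z)
        (trans (cong (_% suc k) sides-agree-at-z)
               (∑-cong-% (suc k) λ b → residues-equal (degB b) (degB-mod b) (degB-total b) m≤1+k z i))
      where
      sides-agree-at-z : ∑[ a < k ] degA a z ≡ ∑[ b < k ] degB b z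
      sides-agree-at-z = begin
        ∑[ a < k ] degA a z           ≡⟨ ∑-degA z ⟩
        occurrences p z + crossing z  ≡⟨ cong (_+ crossing z) (m+n≡0⇒m≡0 _ pz+qz≡0) ⟩
        crossing z                    ≡⟨ cong (_+ crossing z) (m+n≡0⇒n≡0 _ pz+qz≡0) ⟨
        occurrences q z + crossing z  ≡⟨ ∑-degB z ⟨
        ∑[ b < k ] degB b z           ∎
        where open ≡-Reasoning

  impossible : ⊥
  impossible with simple-color 2≤k _ center-mod ∑-center
  ... | i , pi+qi≡1 = m+m≢1 (occurrences p i) (trans (cong (occurrences p i +_) p≡q) pi+qi≡1)
    where
    1<1+k : 1 < suc k
    1<1+k = m≤n⇒m≤1+n 2≤k
    p≡q : occurrences p i ≡ occurrences q i
    p≡q = [i+w]%n≡[j+w]%n⇒i≡j (crossing i)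
            (≤-<-trans (≤-trans (m≤m+n _ _) (≤-reflexive pi+qi≡1)) 1<1+k)
            (≤-<-trans (≤-trans (m≤n+m _ _) (≤-reflexive pi+qi≡1)) 1<1+k)
            (trans (cong (_% suc k) (sym (∑-degA i))) (trans (sides-congruent i) (cong (_% suc k) (∑-degB i))))

module UpperBound {k} (1≤k : 1 ≤ k) where
  open K1kkVertices k

  data Side : Set where
    O   : Side
    A B : Fin k → Side

  side : Fin (1 + k + k) → Side
  side zero    = O
  side (suc w) = [ A , B ]′ (splitAt k w)

  side-vA : ∀ a → side (vA a) ≡ A a
  side-vA a = cong [ A , B ]′ (splitAt-↑ˡ k a k)

  side-vB : ∀ b → side (vB b) ≡ B b
  side-vB b = cong [ A , B ]′ (splitAt-↑ʳ k k b)

  crossColor : Fin k → Fin k → ℕ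
  crossColor a b = (suc (toℕ a) + toℕ b) % suc k

  spokeColor : ℕ → ℕ
  spokeColor zero    = suc k
  spokeColor (suc t) = suc t

  color : Side → Side → ℕ
  color O     (A _) = suc k
  color (A _) O     = suc k
  color O     (B b) = spokeColor (toℕ b)
  color (B b) O     = spokeColor (toℕ b)
  color (A a) (B b) = crossColor a b
  color (B b) (A a) = crossColor a b
  color _     _     = 0   -- pairs inside one part are not edges

  color-sym : ∀ s t → color s t ≡ color t s
  color-sym O     O     = refl
  color-sym O     (A _) = refl
  color-sym O     (B _) = refl
  color-sym (A _) O     = refl
  color-sym (A _) (A _) = refl
  color-sym (A _) (B _) = refl
  color-sym (B _) O     = refl
  color-sym (B _) (A _) = refl
  color-sym (B _) (B _) = refl

  crossColor<1+k : ∀ a b → crossColor a b < suc k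
  crossColor<1+k a b = m%n<n (suc (toℕ a) + toℕ b) (suc k)

  spokeColor≤1+k : ∀ b → spokeColor (toℕ b) ≤ suc k
  spokeColor≤1+k b with toℕ b | toℕ<n b
  ... | zero  | _   = ≤-refl
  ... | suc t | t<k = <⇒≤ (m≤n⇒m≤1+n t<k)

  color≤1+k : ∀ s t → color s t ≤ suc k
  color≤1+k O     O     = z≤n
  color≤1+k O     (A _) = ≤-refl
  color≤1+k O     (B b) = spokeColor≤1+k b
  color≤1+k (A _) O     = ≤-refl
  color≤1+k (A _) (A _) = z≤n
  color≤1+k (A a) (B b) = <⇒≤ (crossColor<1+k a b)
  color≤1+k (B b) O     = spokeColor≤1+k b
  color≤1+k (B b) (A a) = <⇒≤ (crossColor<1+k a b)
  color≤1+k (B _) (B _) = z≤n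

  color<k+2 : ∀ s t → color s t < k + 2
  color<k+2 s t = ≤-trans (s≤s (color≤1+k s t)) (≤-reflexive (+-comm 2 k))

  coloring : EdgeColoring (K1kk k) (k + 2)
  coloring = record
    { col    = λ u v → fromℕ< (color<k+2 (side u) (side v))
    ; colSym = λ u v → fromℕ<-cong _ _ (color-sym (side u) (side v)) _ _
    }

  open Degrees coloring

  toℕ-p : ∀ a → toℕ (p a) ≡ suc k
  toℕ-p a = trans (toℕ-fromℕ< _) (cong (color O) (side-vA a))

  toℕ-q : ∀ b → toℕ (q b) ≡ spokeColor (toℕ b)
  toℕ-q b = trans (toℕ-fromℕ< _) (cong (color O) (side-vB b))

  toℕ-r : ∀ a b → toℕ (r a b) ≡ crossColor a b
  toℕ-r a b = trans (toℕ-fromℕ< _) (cong₂ color (side-vA a) (side-vB b))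

  crossColor-injectiveʳ : ∀ a → Injective _≡_ _≡_ (crossColor a)
  crossColor-injectiveʳ a =
    toℕ-injective ∘ [w+i]%n≡[w+j]%n⇒i≡j (suc (toℕ a)) (m≤n⇒m≤1+n (toℕ<n _)) (m≤n⇒m≤1+n (toℕ<n _))

  crossColor-injectiveˡ : ∀ b → Injective _≡_ _≡_ (λ a → crossColor a b)
  crossColor-injectiveˡ b =
    toℕ-injective ∘ suc-injective ∘ [i+w]%n≡[j+w]%n⇒i≡j (toℕ b) (s≤s (toℕ<n _)) (s≤s (toℕ<n _))

  spokeColor-injective : Injective _≡_ _≡_ (spokeColor ∘ toℕ {k})
  spokeColor-injective {b} {b′} = toℕ-injective ∘ spoke-inj (toℕ<n b) (toℕ<n b′)
    where
    spoke-inj : ∀ {t t′} → t < k → t′ < k → spokeColor t ≡ spokeColor t′ → t ≡ t′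
    spoke-inj {zero}  {zero}   _   _    _  = refl
    spoke-inj {zero}  {suc t′} _   t′<k eq = contradiction (subst (_≤ k) (sym eq) (<⇒≤ t′<k)) 1+n≰n
    spoke-inj {suc t} {zero}   t<k _    eq = contradiction (subst (_≤ k) eq (<⇒≤ t<k)) 1+n≰n
    spoke-inj {suc t} {suc t′} _   _    eq = eq

  spokeColor≢crossColor : ∀ {i t} → i < k → t < k → spokeColor t ≢ (suc i + t) % suc k
  spokeColor≢crossColor {i} {zero} _   _   = <⇒≢ (m%n<n (suc i + 0) (suc k)) ∘ sym
  spokeColor≢crossColor {i} {suc t} i<k t<k = 0≢1+n ∘ [i+w]%n≡[j+w]%n⇒i≡j (suc t) (s≤s z≤n) (s≤s i<k)
                                                  ∘ trans (m<n⇒m%n≡m (m≤n⇒m≤1+n t<k))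

  q-injective : Injective _≡_ _≡_ q
  q-injective = injective-via-toℕ toℕ-q spokeColor-injective

  A-colors-injective : ∀ a → Injective _≡_ _≡_ (p a ∷ r a)
  A-colors-injective a =
    injective-via-toℕ {h = suc k ∷ crossColor a} (λ { zero → toℕ-p a ; (suc b) → toℕ-r a b })
                      (∷-injective (λ b → <⇒≢ (crossColor<1+k a b)) (crossColor-injectiveʳ a))

  B-colors-injective : ∀ b → Injective _≡_ _≡_ (q b ∷ λ a → r a b)
  B-colors-injective b =
    injective-via-toℕ {h = spokeColor (toℕ b) ∷ λ a → crossColor a b} (λ { zero → toℕ-q b ; (suc a) → toℕ-r a b })
                      (∷-injective (λ a → spokeColor≢crossColor (toℕ<n a) (toℕ<n b) ∘ sym) (crossColor-injectiveˡ b))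

  center-degrees : ∀ i → ModDegree k (occurrences p i + occurrences q i)
  center-degrees i with toℕ i ≟ suc k
  ... | no  i≢1+k =
    ≤1⇒ModDegree k (≤-trans (≤-reflexive (cong (_+ occurrences q i) p-misses)) (occurrences≤1 q-injective i))
    where
    p-misses : occurrences p i ≡ 0
    p-misses = ∑-zeros λ a → δ-≢ λ pa≡i → i≢1+k (trans (cong toℕ (sym pa≡i)) (toℕ-p a))
  ... | yes i≡1+k = inj₂ (1 , (begin
    occurrences p i + occurrences q i  ≡⟨ cong₂ _+_ p-hits q-hits-once ⟩
    k + 1                              ≡⟨ +-comm k 1 ⟩
    suc k                              ≡⟨ cong suc (+-identityʳ k) ⟨
    1 + 1 * k                          ∎))
    where
    open ≡-Reasoning
    pa≡i : ∀ a → p a ≡ i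
    pa≡i a = toℕ-injective (trans (toℕ-p a) (sym i≡1+k))
    p-hits : occurrences p i ≡ k
    p-hits = trans (sum-cong-≗ λ a → trans (cong (λ x → δ x i) (pa≡i a)) (δ-refl i)) (∑-ones k)
    b₀ : Fin k
    b₀ = fromℕ< 1≤k
    qb₀≡i : q b₀ ≡ i
    qb₀≡i = toℕ-injective (trans (toℕ-q b₀) (trans (cong spokeColor (toℕ-fromℕ< 1≤k)) (sym i≡1+k)))
    q-hits-once : occurrences q i ≡ 1
    q-hits-once = ≤-antisym (occurrences≤1 q-injective i)
                            (subst (_≤ occurrences q i) (trans (cong (λ x → δ x i) qb₀≡i) (δ-refl i)) (term≤∑ _ b₀))

  coloring-isMod : IsModColoring k (K1kk k) coloring
  coloring-isMod v i with vertex v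
  ... | center-vertex = subst (ModDegree k) (sym (colorDeg-center i)) (center-degrees i)
  ... | A-vertex a    = subst (ModDegree k) (sym (colorDeg-vA a i)) (≤1⇒ModDegree k (occurrences≤1 (A-colors-injective a) i))
  ... | B-vertex b    = subst (ModDegree k) (sym (colorDeg-vB b i)) (≤1⇒ModDegree k (occurrences≤1 (B-colors-injective b) i))

proposition4p1 : ∀ (k : ℕ) → 2 ≤ k → ModChromaticIndex≡ k (K1kk k) (k + 2)
proposition4p1 k 2≤k =
  (UpperBound.coloring 1≤k , UpperBound.coloring-isMod 1≤k) ,
  λ m m<k+2 (c , c-mod) → LowerBound.impossible 2≤k (s≤s⁻¹ (≤-trans m<k+2 (≤-reflexive (+-comm k 2)))) c c-mod
  where
  1≤k : 1 ≤ k
  1≤k = ≤-trans (n≤1+n 1) 2≤k
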